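{- Let $\mathbb{H}$ be the set of hereditarily finite sets and let $d$ be the distance function on $\mathbb{H}$ defined in the context. Then $d$ is a metric on $\mathbb{H}$, and in fact an ultrametric: for all $S,T,U\in\mathbb{H}$, $d(S,T)\le \max(d(S,U),d(U,T))$.
   Context: $\mathbb{H}$ is the set of hereditarily finite sets, i.e. $\mathbb{H}=\bigcup_{k\in\omega}V_k$ with $V_0=\varnothing$, $V_{k+1}=\mathcal{P}(V_k)$. For $S,T\in\mathbb{H}$ define relations $\sim_k$ by: $S\sim_0 T$ always; $S\sim_{k+1}T$ iff for every $s\in S$ there is $t\in T$ with $s\sim_k t$, and for every $t\in T$ there is $s\in S$ with $s\sim_k t$. Define $d(S,T)=0$ if $S=T$, and otherwise $d(S,T)=2^{ -k}$ where $k$ is the least natural number with $S\not\sim_k T$. (Equivalently, inductively: $d(S,T)=0$ if $S=T$; $d(\varnothing,T)=d(T,\varnothing)=1/2$ for $T\neq\varnothing$; and for $S\neq T$ both nonempty, $d(S,T)=\tfrac12\max(\sup_{s\in S}\inf_{t\in T}d(s,t),\ \sup_{t\in T}\inf_{s\in S}d(s,t))$.) -}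

module Defs where

open import Data.Bool using (Bool; true; false; not; if_then_else_; _∧_)
open import Data.Nat using (ℕ; zero; suc; _+_; _≡ᵇ_)
open import Data.Nat.DivMod using (_/_; _%_)
open import Data.List using (List; filter; upTo)
open import Data.Bool.ListAction using (all; any)
open import Data.Rational using (ℚ; 0ℚ; 1ℚ; ½; _*_)
open import Relation.Binary.PropositionalEquality using (_≡_)
open import Relation.Nullary.Decidable using (yes; no)
open import Data.Nat.Properties using (_≟_)
open import Relation.Nullary using (Dec)

-- Hereditarily finite sets, via the Ackermann coding:
-- the natural number n codes the set { m | bit m of n is 1 }.
-- This is a bijection ℕ ≅ 𝕙 respecting ∈, so equality of sets is
-- equality of codes.
HF : Set
HF = ℕ

bit : ℕ → ℕ → Bool
bit zero    n = n % 2 ≡ᵇ 1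
bit (suc m) n = bit m (n / 2)

_∈ᵇ_ : HF → HF → Bool
m ∈ᵇ n = bit m n

-- the list of all elements of n (every element m of n satisfies m < n)
members : HF → List HF
members n = filter (λ m → Data.Bool.T? (m ∈ᵇ n)) (upTo n)
  where import Data.Bool

sim : ℕ → HF → HF → Bool
sim zero    S T = true
sim (suc k) S T =
  all (λ s → any (λ t → sim k s t) (members T)) (members S) ∧
  all (λ t → any (λ s → sim k s t) (members S)) (members T)

half^ : ℕ → ℚ
half^ zero    = 1ℚ
half^ (suc k) = ½ * half^ k

-- least k, searching k, k+1, ..., with the given fuel, such that S ≁_k T.
-- (For S ≠ T such a k exists with k ≤ 1 + max(rank S, rank T) ≤ S + T + 1;
--  the fallback value is never reached for S ≠ T.)
leastNonSim : ℕ → ℕ → HF → HF → ℕ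
leastNonSim zero       k S T = k
leastNonSim (suc fuel) k S T =
  if sim k S T then leastNonSim fuel (suc k) S T else k

d : HF → HF → ℚ
d S T with S ≟ T
... | yes _ = 0ℚ
... | no  _ = half^ (leastNonSim (S + T + 2) 0 S T)

{-# OPTIONS --safe #-}
module Submission where

-- Each ∼ₖ is an equivalence relation: reflexivity, symmetry and transitivity pass
-- through the back-and-forth clause from level k to level k + 1.  So if S ≁ₖ T then
-- S ≁ₖ U or U ≁ₖ T, and since d S T ≥ 2⁻ᵏ whenever S ≁ₖ T, the ultrametric
-- inequality follows (the triangle inequality is weaker).  That d separates points,
-- and that the bounded search inside d never runs out of fuel, holds because
-- S ∼ₖ T with S + T < k already forces S = T: in the Ackermann coding members are
-- smaller than their set, so induction on k reduces this to extensionality.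

open import Defs
open import Data.Bool.ListAction using (all; any)
open import Data.Bool as Bool using (Bool; true; false; T; if_then_else_)
open import Data.Bool.Properties using (T-≡; T-∧)
open import Data.Empty using (⊥-elim)
open import Data.List using (List; upTo)
open import Data.List.Membership.Propositional using (_∈_; find; lose)
import Data.List.Membership.Propositional.Properties as Membership
open import Data.List.Relation.Unary.All as All using (All)
open import Data.List.Relation.Unary.All.Properties using (all⁺; all⁻)
open import Data.List.Relation.Unary.Any as Any using (Any)
open import Data.List.Relation.Unary.Any.Properties using (any⁺; any⁻)
open import Data.Nat as ℕ using (ℕ; zero; suc; _+_; _≡ᵇ_; z≤n; s≤s; z<s; _≤′_; ≤′-refl; ≤′-step)
open import Data.Nat.DivMod using (_/_; _%_; m≡m%n+[m/n]*n; m%n<n; m/n*n≤m; m/n≤m; m/n<m)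
open import Data.Nat.Induction using (<-wellFounded)
import Data.Nat.Properties as ℕ
open import Data.Nat.Properties using (_≟_)
open import Data.Product using (_×_; _,_; proj₁; proj₂)
open import Data.Rational using (0ℚ; 1ℚ; ½; _≤_; _⊔_; _*_)
import Data.Rational as ℚ
import Data.Rational.Properties as ℚ
open import Data.Sum using (_⊎_; inj₁; inj₂)
open import Function using (_∘_; flip; Equivalence)
open import Induction.WellFounded using (Acc; acc)
open import Relation.Binary.PropositionalEquality using (_≡_; _≢_; refl; sym; trans; cong; cong₂; subst; module ≡-Reasoning)
open import Relation.Nullary using (¬_; yes; no; contradiction)
open import Relation.Nullary.Decidable using (T?)

private
  variable
    A B C : Set

Lift : (A → B → Set) → List A → List B → Set
Lift R xs ys = All (λ x → Any (R x) ys) xs × All (λ y → Any (flip R y) xs) ys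

Lift-refl : {R : A → A → Set} {xs : List A} → (∀ {x} → R x x) → Lift R xs xs
Lift-refl r = All.tabulate (λ x∈xs → lose x∈xs r) , All.tabulate (λ x∈xs → lose x∈xs r)

Lift-sym : {R : A → B → Set} {R′ : B → A → Set} {xs : List A} {ys : List B} →
           (∀ {x y} → R x y → R′ y x) → Lift R xs ys → Lift R′ ys xs
Lift-sym r (forth , back) = All.map (Any.map r) back , All.map (Any.map r) forth

module _ {R : A → B → Set} {R′ : B → C → Set} {R″ : A → C → Set}
         (compose : ∀ {x y z} → R x y → R′ y z → R″ x z) where

  Any-compose : ∀ {x ys zs} → Any (R x) ys → All (λ y → Any (R′ y) zs) ys → Any (R″ x) zs
  Any-compose Rx R′ys with _ , y∈ys , Rxy ← find Rx = Any.map (compose Rxy) (All.lookup R′ys y∈ys)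

Lift-trans : {R : A → B → Set} {R′ : B → C → Set} {R″ : A → C → Set} →
             (∀ {x y z} → R x y → R′ y z → R″ x z) →
             ∀ {xs ys zs} → Lift R xs ys → Lift R′ ys zs → Lift R″ xs zs
Lift-trans {R = R} {R′} {R″} compose (forth₁ , back₁) (forth₂ , back₂) =
  All.map (λ Rx → Any-compose {R = R} {R′} {R″} compose Rx forth₂) forth₁ ,
  All.map (λ R′z → Any-compose {R = flip R′} {R′ = flip R} {R″ = flip R″}
                     (λ R′yz Rxy → compose Rxy R′yz) R′z back₁) back₂

T-injective : {a b : Bool} → (T a → T b) → (T b → T a) → a ≡ b
T-injective {false} {false} _ _ = refl
T-injective {false} {true}  _ b⇒a = ⊥-elim (b⇒a _)
T-injective {true}  {false} a⇒b _ = ⊥-elim (a⇒b _)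
T-injective {true}  {true}  _ _ = refl

≡ᵇ1-injective : ∀ {a b} → a ℕ.< 2 → b ℕ.< 2 → (a ≡ᵇ 1) ≡ (b ≡ᵇ 1) → a ≡ b
≡ᵇ1-injective {0} {0} _ _ _ = refl
≡ᵇ1-injective {1} {1} _ _ _ = refl
≡ᵇ1-injective {0} {1} _ _ ()
≡ᵇ1-injective {1} {0} _ _ ()
≡ᵇ1-injective {suc (suc _)} (s≤s (s≤s ())) _ _
≡ᵇ1-injective {b = suc (suc _)} _ (s≤s (s≤s ())) _

≡-from-bit0-and-half : ∀ S T → bit 0 S ≡ bit 0 T → S / 2 ≡ T / 2 → S ≡ T
≡-from-bit0-and-half S T bit0 half = begin
  S                   ≡⟨ m≡m%n+[m/n]*n S 2 ⟩
  S % 2 + S / 2 ℕ.* 2 ≡⟨ cong₂ (λ r q → r + q ℕ.* 2) (≡ᵇ1-injective (m%n<n S 2) (m%n<n T 2) bit0) half ⟩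
  T % 2 + T / 2 ℕ.* 2 ≡⟨ sym (m≡m%n+[m/n]*n T 2) ⟩
  T                   ∎
  where open ≡-Reasoning

bits-injective-acc : ∀ S T → Acc ℕ._<_ (S + T) → (∀ m → bit m S ≡ bit m T) → S ≡ T
bits-injective-acc zero zero _ _ = refl
bits-injective-acc zero (suc t) (acc rs) bits =
  ≡-from-bit0-and-half 0 (suc t) (bits 0)
    (bits-injective-acc 0 (suc t / 2) (rs (m/n<m (suc t) 2 (ℕ.n<1+n 1))) (bits ∘ suc))
bits-injective-acc (suc s) T (acc rs) bits =
  ≡-from-bit0-and-half (suc s) T (bits 0)
    (bits-injective-acc (suc s / 2) (T / 2)
      (rs (ℕ.+-mono-<-≤ (m/n<m (suc s) 2 (ℕ.n<1+n 1)) (m/n≤m T 2))) (bits ∘ suc))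

bits-injective : ∀ S T → (∀ m → bit m S ≡ bit m T) → S ≡ T
bits-injective S T = bits-injective-acc S T (<-wellFounded (S + T))

bit-< : ∀ m n → T (bit m n) → m ℕ.< n
bit-< zero    (suc n) _ = z<s
bit-< (suc m) n m∈n/2 = begin-strict
  suc m           <⟨ ℕ.m<m*n (suc m) 2 (ℕ.n<1+n 1) ⟩
  suc m ℕ.* 2     ≤⟨ ℕ.*-monoˡ-≤ 2 (bit-< m (n / 2) m∈n/2) ⟩
  (n / 2) ℕ.* 2   ≤⟨ m/n*n≤m n 2 ⟩
  n               ∎
  where open ℕ.≤-Reasoning

∈-members⁺ : ∀ {m n} → T (bit m n) → m ∈ members n
∈-members⁺ {m} {n} m∈n =
  Membership.∈-filter⁺ (λ k → T? (bit k n)) (Membership.∈-upTo⁺ (bit-< m n m∈n)) m∈n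

∈-members⁻ : ∀ {m n} → m ∈ members n → T (bit m n)
∈-members⁻ {n = n} = proj₂ ∘ Membership.∈-filter⁻ (λ k → T? (bit k n)) {xs = upTo n}

members-< : ∀ {m} n → m ∈ members n → m ℕ.< n
members-< {m} n = bit-< m n ∘ ∈-members⁻

members-injective : ∀ {S T} → (∀ {m} → m ∈ members S → m ∈ members T) →
                    (∀ {m} → m ∈ members T → m ∈ members S) → S ≡ T
members-injective {S} {T} S⊆T T⊆S = bits-injective S T λ m →
  T-injective (∈-members⁻ ∘ S⊆T ∘ ∈-members⁺ {m}) (∈-members⁻ ∘ T⊆S ∘ ∈-members⁺ {m})

infix 4 _∼[_]_
_∼[_]_ : HF → ℕ → HF → Set
x ∼[ k ] y = T (sim k x y)

module _ (k : ℕ) (S T : HF) where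
  private
    Forth Back : Bool
    Forth = all (λ s → any (λ t → sim k s t) (members T)) (members S)
    Back  = all (λ t → any (λ s → sim k s t) (members S)) (members T)

  ∼-suc⁻ : S ∼[ suc k ] T → Lift _∼[ k ]_ (members S) (members T)
  ∼-suc⁻ S∼T = let forth , back = Equivalence.to (T-∧ {Forth} {Back}) S∼T in
    All.map (any⁻ _ _) (all⁺ _ _ forth) , All.map (any⁻ _ _) (all⁺ _ _ back)

  ∼-suc⁺ : Lift _∼[ k ]_ (members S) (members T) → S ∼[ suc k ] T
  ∼-suc⁺ (forth , back) = Equivalence.from (T-∧ {Forth} {Back})
    (all⁻ _ (All.map (any⁺ _) forth) , all⁻ _ (All.map (any⁺ _) back))

∼-refl : ∀ k {S} → S ∼[ k ] S
∼-refl zero    = _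
∼-refl (suc k) {S} = ∼-suc⁺ k S S (Lift-refl (∼-refl k))

∼-sym : ∀ k {S T} → S ∼[ k ] T → T ∼[ k ] S
∼-sym zero    _   = _
∼-sym (suc k) {S} {T} S∼T = ∼-suc⁺ k T S (Lift-sym (∼-sym k) (∼-suc⁻ k S T S∼T))

∼-trans : ∀ k {S U T} → S ∼[ k ] U → U ∼[ k ] T → S ∼[ k ] T
∼-trans zero    _   _   = _
∼-trans (suc k) {S} {U} {T} S∼U U∼T =
  ∼-suc⁺ k S T (Lift-trans (∼-trans k) (∼-suc⁻ k S U S∼U) (∼-suc⁻ k U T U∼T))

sim-comm : ∀ k S T → sim k S T ≡ sim k T S
sim-comm k S T = T-injective (∼-sym k) (∼-sym k)

members-sum-< : ∀ {s t} S T → s ∈ members S → t ∈ members T → suc (s + t) ℕ.< S + T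
members-sum-< {s} {t} S T s∈S t∈T =
  subst (ℕ._≤ S + T) (cong suc (ℕ.+-suc s t)) (ℕ.+-mono-≤ (members-< S s∈S) (members-< T t∈T))

∼-separates : ∀ k {S T} → S + T ℕ.< k → S ∼[ k ] T → S ≡ T
∼-separates (suc k) {S} {T} S+T<1+k S∼T = members-injective S⊆T T⊆S
  where
  lifted : Lift _∼[ k ]_ (members S) (members T)
  lifted = ∼-suc⁻ k S T S∼T

  sum-< : ∀ {s t} → s ∈ members S → t ∈ members T → s + t ℕ.< k
  sum-< s∈S t∈T = ℕ.≤-pred (ℕ.<-trans (members-sum-< S T s∈S t∈T) S+T<1+k)

  S⊆T : ∀ {m} → m ∈ members S → m ∈ members T
  S⊆T m∈S with t , t∈T , m∼t ← find (All.lookup (proj₁ lifted) m∈S) =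
    subst (_∈ members T) (sym (∼-separates k (sum-< m∈S t∈T) m∼t)) t∈T

  T⊆S : ∀ {m} → m ∈ members T → m ∈ members S
  T⊆S m∈T with s , s∈S , s∼m ← find (All.lookup (proj₂ lifted) m∈T) =
    subst (_∈ members S) (∼-separates k (sum-< s∈S m∈T) s∼m) s∈S

leastNonSim-comm : ∀ fuel k S T → leastNonSim fuel k S T ≡ leastNonSim fuel k T S
leastNonSim-comm zero       k S T = refl
leastNonSim-comm (suc fuel) k S T rewrite sim-comm k S T =
  cong (λ l → if sim k T S then l else k) (leastNonSim-comm fuel (suc k) S T)

∼-below-leastNonSim : ∀ fuel {k j} S T → k ℕ.≤ j → j ℕ.< leastNonSim fuel k S T → S ∼[ j ] T
∼-below-leastNonSim zero S T k≤j j<k = contradiction k≤j (ℕ.<⇒≱ j<k)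
∼-below-leastNonSim (suc fuel) {k} S T k≤j j<l with sim k S T in S∼T | ℕ.m≤n⇒m<n∨m≡n k≤j
... | false | _        = contradiction k≤j (ℕ.<⇒≱ j<l)
... | true  | inj₁ k<j = ∼-below-leastNonSim fuel S T k<j j<l
... | true  | inj₂ refl = Equivalence.from T-≡ S∼T

leastNonSim-spec : ∀ fuel k S T → leastNonSim fuel k S T ≡ k + fuel ⊎ ¬ S ∼[ leastNonSim fuel k S T ] T
leastNonSim-spec zero       k S T = inj₁ (sym (ℕ.+-identityʳ k))
leastNonSim-spec (suc fuel) k S T with sim k S T in S∼T
... | false = inj₂ (subst Bool.T S∼T)
... | true with leastNonSim-spec fuel (suc k) S T
...   | inj₁ exhausted = inj₁ (trans exhausted (sym (ℕ.+-suc k fuel)))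
...   | inj₂ ¬∼       = inj₂ ¬∼

splitLevel : HF → HF → ℕ
splitLevel S T = leastNonSim (S + T + 2) 0 S T

splitLevel-comm : ∀ S T → splitLevel S T ≡ splitLevel T S
splitLevel-comm S T =
  trans (cong (λ n → leastNonSim (n + 2) 0 S T) (ℕ.+-comm S T)) (leastNonSim-comm (T + S + 2) 0 S T)

∼-below-splitLevel : ∀ {j} S T → j ℕ.< splitLevel S T → S ∼[ j ] T
∼-below-splitLevel S T = ∼-below-leastNonSim (S + T + 2) S T z≤n

≁-at-splitLevel : ∀ {S T} → S ≢ T → ¬ S ∼[ splitLevel S T ] T
≁-at-splitLevel {S} {T} S≢T with leastNonSim-spec (S + T + 2) 0 S T
... | inj₂ S≁T       = S≁T
... | inj₁ exhausted =
  contradiction (∼-separates (S + T + 1) (ℕ.m<m+n (S + T) z<s) (∼-below-splitLevel S T below-fuel)) S≢T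
  where
  below-fuel : S + T + 1 ℕ.< splitLevel S T
  below-fuel = subst (S + T + 1 ℕ.<_) (sym exhausted) (ℕ.+-monoʳ-< (S + T) (ℕ.n<1+n 1))

half^-positive : ∀ k → ℚ.Positive (half^ k)
half^-positive zero    = _
half^-positive (suc k) = ℚ.pos*pos⇒pos ½ (half^ k) {{half^-positive k}}

half^-nonneg : ∀ k → 0ℚ ≤ half^ k
half^-nonneg k = ℚ.<⇒≤ (ℚ.positive⁻¹ (half^ k) {{half^-positive k}})

half^-≢0 : ∀ k → half^ k ≢ 0ℚ
half^-≢0 k = ℚ.<⇒≢ (ℚ.positive⁻¹ (half^ k) {{half^-positive k}}) ∘ sym

half^-suc-≤ : ∀ k → half^ (suc k) ≤ half^ k
half^-suc-≤ k = begin
  ½ * half^ k   ≤⟨ ℚ.*-monoʳ-≤-nonNeg (half^ k) {{ℚ.pos⇒nonNeg (half^ k) {{half^-positive k}}}} (ℚ.≤ᵇ⇒≤ {½} {1ℚ} _) ⟩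
  1ℚ * half^ k  ≡⟨ ℚ.*-identityˡ (half^ k) ⟩
  half^ k       ∎
  where open ℚ.≤-Reasoning

half^-antitone′ : ∀ {m n} → m ≤′ n → half^ n ≤ half^ m
half^-antitone′ ≤′-refl      = ℚ.≤-refl
half^-antitone′ (≤′-step {n} m≤n) = ℚ.≤-trans (half^-suc-≤ n) (half^-antitone′ m≤n)

half^-antitone : ∀ {m n} → m ℕ.≤ n → half^ n ≤ half^ m
half^-antitone = half^-antitone′ ∘ ℕ.≤⇒≤′

⊔≤+ : ∀ {p q} → 0ℚ ≤ p → 0ℚ ≤ q → p ⊔ q ≤ p ℚ.+ q
⊔≤+ {p} {q} 0≤p 0≤q = ℚ.⊔-lub
  (begin p ≡⟨ ℚ.+-identityʳ p ⟨ p ℚ.+ 0ℚ ≤⟨ ℚ.+-monoʳ-≤ p 0≤q ⟩ p ℚ.+ q ∎)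
  (begin q ≡⟨ ℚ.+-identityˡ q ⟨ 0ℚ ℚ.+ q ≤⟨ ℚ.+-monoˡ-≤ q 0≤p ⟩ p ℚ.+ q ∎)
  where open ℚ.≤-Reasoning

d-refl : ∀ S → d S S ≡ 0ℚ
d-refl S with S ≟ S
... | yes _   = refl
... | no S≢S = contradiction refl S≢S

d-apart : ∀ {S T} → S ≢ T → d S T ≡ half^ (splitLevel S T)
d-apart {S} {T} S≢T with S ≟ T
... | yes S≡T = contradiction S≡T S≢T
... | no  _   = refl

d-nonneg : ∀ S T → 0ℚ ≤ d S T
d-nonneg S T with S ≟ T
... | yes _ = ℚ.≤-refl
... | no  _ = half^-nonneg (splitLevel S T)

d≡0⇒≡ : ∀ S T → d S T ≡ 0ℚ → S ≡ T
d≡0⇒≡ S T with S ≟ T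
... | yes S≡T = λ _ → S≡T
... | no  _   = ⊥-elim ∘ half^-≢0 (splitLevel S T)

d-comm : ∀ S T → d S T ≡ d T S
d-comm S T with S ≟ T
... | yes refl = sym (d-refl S)
... | no  S≢T  = trans (cong half^ (splitLevel-comm S T)) (sym (d-apart (S≢T ∘ sym)))

half^≤d : ∀ k S T → ¬ S ∼[ k ] T → half^ k ≤ d S T
half^≤d k S T S≁T = begin
  half^ k                 ≤⟨ half^-antitone (ℕ.≮⇒≥ (S≁T ∘ ∼-below-splitLevel {k} S T)) ⟩
  half^ (splitLevel S T)  ≡⟨ sym (d-apart S≢T) ⟩
  d S T                   ∎
  where
  open ℚ.≤-Reasoning
  S≢T : S ≢ T
  S≢T refl = S≁T (∼-refl k)

d-ultrametric : ∀ S T U → d S T ≤ d S U ⊔ d U T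
d-ultrametric S T U with S ≟ T
... | yes _   = ℚ.≤-trans (d-nonneg S U) (ℚ.p≤p⊔q (d S U) (d U T))
... | no  S≢T with T? (sim (splitLevel S T) S U)
...   | no  S≁U = ℚ.≤-trans (half^≤d (splitLevel S T) S U S≁U) (ℚ.p≤p⊔q (d S U) (d U T))
...   | yes S∼U = ℚ.≤-trans (half^≤d (splitLevel S T) U T U≁T) (ℚ.p≤q⊔p (d S U) (d U T))
  where
  U≁T : ¬ U ∼[ splitLevel S T ] T
  U≁T U∼T = ≁-at-splitLevel S≢T (∼-trans (splitLevel S T) S∼U U∼T)

d-triangle : ∀ S T U → d S T ≤ d S U ℚ.+ d U T
d-triangle S T U = ℚ.≤-trans (d-ultrametric S T U) (⊔≤+ (d-nonneg S U) (d-nonneg U T))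

mainTheorem1 :
    -- d is a metric on 𝕙 ...
    ((S T : HF) → 0ℚ ≤ d S T)
    × ((S T : HF) → d S T ≡ 0ℚ → S ≡ T)
    × ((S : HF) → d S S ≡ 0ℚ)
    × ((S T : HF) → d S T ≡ d T S)
    × ((S T U : HF) → d S T ≤ d S U Data.Rational.+ d U T)
    -- ... and in fact an ultrametric
    × ((S T U : HF) → d S T ≤ (d S U ⊔ d U T))
mainTheorem1 = d-nonneg , d≡0⇒≡ , d-refl , d-comm , d-triangle , d-ultrametric
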